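{- Let $\tau$ be a functor in the sense described in the context, let $\alpha,\beta$ be representable types, and let $f:\alpha\to\beta$ be continuous with $f(\bot)=\bot$. Then $\mathrm{fmap}_{\alpha,\beta}(f)(\bot)=\bot$.
   Context: All types are pointed cpos (pcpos): partial orders with a least element $\bot$ in which every countable increasing chain has a least upper bound. $\alpha\to\beta$ denotes the pcpo of continuous functions from $\alpha$ to $\beta$, ordered pointwise; $\circ$ is composition and $\mathrm{id}$ the identity. Fix a pcpo $\mathcal{U}$ (the universal domain). A representable type is a pcpo $\alpha$ together with continuous maps $\mathrm{emb}_\alpha:\alpha\to\mathcal{U}$ and $\mathrm{proj}_\alpha:\mathcal{U}\to\alpha$ such that $\mathrm{proj}_\alpha\circ\mathrm{emb}_\alpha=\mathrm{id}_\alpha$ and $\mathrm{emb}_\alpha\circ\mathrm{proj}_\alpha\sqsubseteq\mathrm{id}_{\mathcal{U}}$. $\mathcal{U}$ is representable with $\mathrm{emb}_{\mathcal{U}}=\mathrm{proj}_{\mathcal{U}}=\mathrm{id}_{\mathcal{U}}$. If $\alpha,\beta$ are representable, then $\alpha\to\beta$ is representable with $\mathrm{emb}_{\alpha\to\beta}(h)=\mathrm{in}(\mathrm{emb}_\beta\circ h\circ\mathrm{proj}_\alpha)$ and $\mathrm{proj}_{\alpha\to\beta}(u)=\mathrm{proj}_\beta\circ\mathrm{out}(u)\circ\mathrm{emb}_\alpha$. Here $\mathrm{in}:(\mathcal{U}\to\mathcal{U})\to\mathcal{U}$ and $\mathrm{out}:\mathcal{U}\to(\mathcal{U}\to\mathcal{U})$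 are fixed continuous maps with $\mathrm{out}\circ\mathrm{in}=\mathrm{id}$ and $\mathrm{in}\circ\mathrm{out}\sqsubseteq\mathrm{id}$. For representable $\alpha,\beta$, define $\mathrm{coerce}_{\alpha,\beta}=\mathrm{proj}_\beta\circ\mathrm{emb}_\alpha:\alpha\to\beta$ and $\mathrm{REP}(\alpha)=\mathrm{emb}_\alpha\circ\mathrm{proj}_\alpha$. Let $\mathcal{D}$ be the pcpo of deflations on $\mathcal{U}$, i.e. continuous $d:\mathcal{U}\to\mathcal{U}$ with $d\circ d=d\sqsubseteq\mathrm{id}_{\mathcal{U}}$, ordered pointwise. A type constructor $\tau$ is given by a continuous map $T_\tau:\mathcal{D}\to\mathcal{D}$. For representable $\alpha$, the type $\tau\cdot\alpha$ is the sub-pcpo $\{u\in\mathcal{U}\mid T_\tau(\mathrm{REP}(\alpha))(u)=u\}$. It is represented with $\mathrm{emb}_{\tau\cdot\alpha}$ the inclusion and $\mathrm{proj}_{\tau\cdot\alpha}=T_\tau(\mathrm{REP}(\alpha))$. $\tau$ is a functor if it comes with a continuous $\underline{\mathrm{fmap}}:(\mathcal{U}\to\mathcal{U})\to(\tau\cdot\mathcal{U}\to\tau\cdot\mathcal{U})$ satisfying: (F1) for every $d\in\mathcal{D}$, $\mathrm{emb}_{\tau\cdot\mathcal{U}}\circ\underline{\mathrm{fmap}}(d)\circ\mathrm{proj}_{\tau\cdot\mathcal{U}}=T_\tau(d)$; (F2) $\underline{\mathrm{fmap}}(f\circ g)=\underline{\mathrm{fmap}}(f)\circ\underline{\mathrm{fmap}}(g)$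 for all $f,g:\mathcal{U}\to\mathcal{U}$. For representable $\alpha,\beta$, the polymorphic map $\mathrm{fmap}_{\alpha,\beta}:(\alpha\to\beta)\to(\tau\cdot\alpha\to\tau\cdot\beta)$ is $\mathrm{fmap}_{\alpha,\beta}(f)=\mathrm{coerce}_{\tau\cdot\mathcal{U},\tau\cdot\beta}\circ\underline{\mathrm{fmap}}(\mathrm{emb}_\beta\circ f\circ\mathrm{proj}_\alpha)\circ\mathrm{coerce}_{\tau\cdot\alpha,\tau\cdot\mathcal{U}}$. -}

module Defs where

open import Level using (0ℓ)
open import Data.Nat using (ℕ; suc)
open import Data.Product using (Σ; _,_; proj₁; proj₂; _×_)
open import Relation.Binary.Bundles using (Poset)
open import Relation.Binary.Structures using (IsPartialOrder; IsPreorder; IsEquivalence)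

Pos : Set₁
Pos = Poset 0ℓ 0ℓ 0ℓ

module _ (P : Pos) where
  open Poset P

  record Chain : Set where
    field
      seq  : ℕ → Carrier
      mono : ∀ n → seq n ≤ seq (suc n)

  IsLub : Chain → Carrier → Set
  IsLub c x = (∀ n → Chain.seq c n ≤ x) × (∀ y → (∀ n → Chain.seq c n ≤ y) → x ≤ y)

record Continuous (P Q : Pos) : Set where
  private
    module P = Poset P
    module Q = Poset Q
  field
    fun      : P.Carrier → Q.Carrier
    cong     : ∀ {x y} → x P.≈ y → fun x Q.≈ fun y
    mono     : ∀ {x y} → x P.≤ y → fun x Q.≤ fun y
    lub-pres : ∀ (c : Chain P) x → IsLub P c x →
               IsLub Q (record { seq = λ n → fun (Chain.seq c n)
                               ; mono = λ n → mono (Chain.mono c n) }) (fun x)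

open Continuous public

idC : ∀ {P} → Continuous P P
idC {P} = record { fun = λ x → x ; cong = λ e → e ; mono = λ l → l
                 ; lub-pres = λ c x l → l }

infixr 9 _∘C_
_∘C_ : ∀ {P Q R} → Continuous Q R → Continuous P Q → Continuous P R
g ∘C f = record
  { fun = λ x → fun g (fun f x)
  ; cong = λ e → cong g (cong f e)
  ; mono = λ l → mono g (mono f l)
  ; lub-pres = λ c x l → lub-pres g (record { seq = λ n → fun f (Chain.seq c n) ; mono = λ n → mono f (Chain.mono c n) }) (fun f x) (lub-pres f c x l) }

[_⇒_] : Pos → Pos → Pos
[ P ⇒ Q ] = record
  { Carrier = Continuous P Q
  ; _≈_ = λ f g → ∀ x → fun f x Q.≈ fun g x
  ; _≤_ = λ f g → ∀ x → fun f x Q.≤ fun g x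
  ; isPartialOrder = record
    { isPreorder = record
      { isEquivalence = record
        { refl = λ x → Q.Eq.refl
        ; sym = λ e x → Q.Eq.sym (e x)
        ; trans = λ e e' x → Q.Eq.trans (e x) (e' x) }
      ; reflexive = λ e x → Q.reflexive (e x)
      ; trans = λ l l' x → Q.trans (l x) (l' x) }
    ; antisym = λ l l' x → Q.antisym (l x) (l' x) } }
  where module Q = Poset Q

record Pcpo : Set₁ where
  field
    poset : Pos
  open Poset poset public
  field
    ⊥       : Carrier
    ⊥-least : ∀ x → ⊥ ≤ x
    ⊔       : Chain poset → Carrier
    ⊔-lub   : ∀ c → IsLub poset c (⊔ c)

open Pcpo using (poset)

module _ (P : Pos) where
  open Poset P
  lub-unique : ∀ c x y → IsLub P c x → IsLub P c y → x ≈ y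
  lub-unique c x y (ux , lx) (uy , ly) = antisym (lx y uy) (ly x ux)

  lub-transfer : ∀ (c d : Chain P) x → (∀ n → Chain.seq c n ≈ Chain.seq d n) →
                 IsLub P c x → IsLub P d x
  lub-transfer c d x e (u , l) =
    (λ n → trans (reflexive (Eq.sym (e n))) (u n)) ,
    (λ y uy → l y (λ n → trans (reflexive (e n)) (uy n)))

record Deflation (U : Pcpo) : Set where
  private module U = Pcpo U
  field
    map   : Continuous (poset U) (poset U)
    idem  : ∀ x → fun map (fun map x) U.≈ fun map x
    below : ∀ x → fun map x U.≤ x

open Deflation public

DefPoset : Pcpo → Pos
DefPoset U = record
  { Carrier = Deflation U
  ; _≈_ = λ d e → ∀ x → fun (map d) x U.≈ fun (map e) x
  ; _≤_ = λ d e → ∀ x → fun (map d) x U.≤ fun (map e) x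
  ; isPartialOrder = record
    { isPreorder = record
      { isEquivalence = record
        { refl = λ x → U.Eq.refl
        ; sym = λ e x → U.Eq.sym (e x)
        ; trans = λ e e' x → U.Eq.trans (e x) (e' x) }
      ; reflexive = λ e x → U.reflexive (e x)
      ; trans = λ l l' x → U.trans (l x) (l' x) }
    ; antisym = λ l l' x → U.antisym (l x) (l' x) } }
  where module U = Pcpo U

record Universe : Set₁ where
  field
    U   : Pcpo
  private module U = Pcpo U
  field
    inn    : Continuous [ poset U ⇒ poset U ] (poset U)
    out    : Continuous (poset U) [ poset U ⇒ poset U ]
    out-in : ∀ f x → fun (fun out (fun inn f)) x U.≈ fun f x
    in-out : ∀ u → fun inn (fun out u) U.≤ u

record Representable (U A : Pcpo) : Set where
  private
    module U = Pcpo U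
    module A = Pcpo A
  field
    emb      : Continuous (poset A) (poset U)
    proj     : Continuous (poset U) (poset A)
    proj-emb : ∀ x → fun proj (fun emb x) A.≈ x
    emb-proj : ∀ u → fun emb (fun proj u) U.≤ u

open Representable public

idRep : (U : Pcpo) → Representable U U
idRep U = record { emb = idC ; proj = idC
                 ; proj-emb = λ x → Pcpo.Eq.refl U
                 ; emb-proj = λ u → Pcpo.refl U }

coerce : ∀ {U A B} → Representable U A → Representable U B →
         Continuous (poset A) (poset B)
coerce rA rB = proj rB ∘C emb rA

REP : ∀ {U A} → Representable U A → Deflation U
REP {U} {A} r = record
  { map = emb r ∘C proj r
  ; idem = λ x → cong (emb r) (proj-emb r (fun (proj r) x))
  ; below = emb-proj r }

TypeCon : Pcpo → Set
TypeCon U = Continuous (DefPoset U) (DefPoset U)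

FixPcpo : (U : Pcpo) → Deflation U → Pcpo
FixPcpo U d = record
  { poset = P
  ; ⊥ = U.⊥ , U.antisym (below d U.⊥) (U.⊥-least _)
  ; ⊥-least = λ x → U.⊥-least (proj₁ x)
  ; ⊔ = λ c → U.⊔ (under c) , fixed c
  ; ⊔-lub = λ c → proj₁ (U.⊔-lub (under c)) ,
                  λ y uy → proj₂ (U.⊔-lub (under c)) (proj₁ y) uy }
  where
  module U = Pcpo U
  Fix = Σ U.Carrier (λ u → fun (map d) u U.≈ u)
  P : Pos
  P = record
    { Carrier = Fix
    ; _≈_ = λ x y → proj₁ x U.≈ proj₁ y
    ; _≤_ = λ x y → proj₁ x U.≤ proj₁ y
    ; isPartialOrder = record
      { isPreorder = record
        { isEquivalence = record
          { refl = U.Eq.refl ; sym = U.Eq.sym ; trans = U.Eq.trans }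
        ; reflexive = U.reflexive
        ; trans = U.trans }
      ; antisym = U.antisym } }
  under : Chain P → Chain (poset U)
  under c = record { seq = λ n → proj₁ (Chain.seq c n) ; mono = Chain.mono c }
  fixed : ∀ c → fun (map d) (U.⊔ (under c)) U.≈ U.⊔ (under c)
  fixed c = lub-unique (poset U) (under c) _ _
    (lub-transfer (poset U)
      (record { seq = λ n → fun (map d) (proj₁ (Chain.seq c n))
              ; mono = λ n → mono (map d) (Chain.mono c n) })
      (under c) _ (λ n → proj₂ (Chain.seq c n))
      (lub-pres (map d) (under c) _ (U.⊔-lub (under c))))
    (U.⊔-lub (under c))

FixRep : (U : Pcpo) (d : Deflation U) → Representable U (FixPcpo U d)
FixRep U d = record
  { emb = record { fun = proj₁ ; cong = λ e → e ; mono = λ l → l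
                 ; lub-pres = λ c x l → proj₁ l ,
                     λ y uy → U.trans (proj₂ l (fun (map d) y , idem d y)
                                 (λ n → U.trans (U.reflexive (U.Eq.sym (proj₂ (Chain.seq c n))))
                                                (mono (map d) (uy n))))
                              (below d y) }
  ; proj = record
    { fun = λ u → fun (map d) u , idem d u
    ; cong = cong (map d)
    ; mono = mono (map d)
    ; lub-pres = λ c x l → proj₁ (lub-pres (map d) c x l) ,
                           λ y → proj₂ (lub-pres (map d) c x l) (proj₁ y) }
  ; proj-emb = λ x → proj₂ x
  ; emb-proj = below d }
  where module U = Pcpo U

_·_ : ∀ {U A} → TypeCon U → Representable U A → Pcpo
_·_ {U} T r = FixPcpo U (fun T (REP r))

·Rep : ∀ {U A} (T : TypeCon U) (r : Representable U A) → Representable U (T · r)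
·Rep {U} T r = FixRep U (fun T (REP r))

record Functor (U : Pcpo) (T : TypeCon U) : Set where
  private
    module U = Pcpo U
    τU = T · idRep U
    module τU = Pcpo τU
  field
    fmap̲ : Continuous [ poset U ⇒ poset U ] [ poset τU ⇒ poset τU ]
    F1 : ∀ (d : Deflation U) (u : U.Carrier) →
         fun (emb (·Rep T (idRep U)) ∘C fun fmap̲ (map d) ∘C proj (·Rep T (idRep U))) u
           U.≈ fun (map (fun T d)) u
    F2 : ∀ (f g : Continuous (poset U) (poset U)) (x : τU.Carrier) →
         fun (fun fmap̲ (f ∘C g)) x τU.≈ fun (fun fmap̲ f ∘C fun fmap̲ g) x

open Functor public

fmap : ∀ {U A B} {T : TypeCon U} → Functor U T →
       (rA : Representable U A) (rB : Representable U B) →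
       Continuous (poset A) (poset B) →
       Continuous (poset (T · rA)) (poset (T · rB))
fmap {U} {T = T} F rA rB f =
  coerce (·Rep T (idRep U)) (·Rep T rB)
  ∘C fun (fmap̲ F) (emb rB ∘C f ∘C proj rA)
  ∘C coerce (·Rep T rA) (·Rep T (idRep U))

module Submission where

-- Write a continuous map between pcpos as *strict* when it sends ⊥ to ⊥.
-- Strict maps are closed under composition, and embeddings and projections
-- of representable types are strict; hence so are the coercions.  Since
--   fmap_{α,β}(f) = coerce ∘ fmap̲(emb_β ∘ f ∘ proj_α) ∘ coerce,
-- the theorem reduces to the key lemma: fmap̲(g) is strict for strict g.
-- For this, let d⊥ be the constant-⊥ deflation.  By (F1), fmap̲(d⊥) agrees
-- with the deflation T(d⊥), which lies below the identity, so fmap̲(d⊥) is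
-- strict.  A strict g satisfies g ∘ d⊥ = d⊥, so by (F2)
--   fmap̲(g)(⊥) = fmap̲(g)(fmap̲(d⊥)(⊥)) = fmap̲(g ∘ d⊥)(⊥) = fmap̲(d⊥)(⊥) = ⊥.

open import Defs
open Pcpo using (poset)
open import Data.Product using (_,_)
open import Relation.Binary.Bundles using (Poset)

≤⊥⇒≈⊥ : (P : Pcpo) {x : Pcpo.Carrier P} → Pcpo._≤_ P x (Pcpo.⊥ P) → Pcpo._≈_ P x (Pcpo.⊥ P)
≤⊥⇒≈⊥ P x≤⊥ = Pcpo.antisym P x≤⊥ (Pcpo.⊥-least P _)

Strict : (P Q : Pcpo) → Continuous (poset P) (poset Q) → Set
Strict P Q f = Pcpo._≈_ Q (fun f (Pcpo.⊥ P)) (Pcpo.⊥ Q)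

∘-strict : (P Q R : Pcpo) (g : Continuous (poset Q) (poset R)) (f : Continuous (poset P) (poset Q)) →
           Strict Q R g → Strict P Q f → Strict P R (g ∘C f)
∘-strict P Q R g f g-strict f-strict = Pcpo.Eq.trans R (cong g f-strict) g-strict

module _ {U A : Pcpo} (r : Representable U A) where
  private
    module U = Pcpo U
    module A = Pcpo A

  -- proj(⊥) ⊑ proj(emb(⊥)) = ⊥.
  proj-strict : Strict U A (proj r)
  proj-strict = ≤⊥⇒≈⊥ A (A.trans (mono (proj r) (U.⊥-least _)) (A.reflexive (proj-emb r A.⊥)))

  -- emb(⊥) ⊑ emb(proj(⊥)) ⊑ ⊥.
  emb-strict : Strict A U (emb r)
  emb-strict = ≤⊥⇒≈⊥ U (U.trans (mono (emb r) (A.⊥-least _)) (emb-proj r U.⊥))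

coerce-strict : {U A B : Pcpo} (rA : Representable U A) (rB : Representable U B) →
                Strict A B (coerce rA rB)
coerce-strict {U} {A} {B} rA rB = ∘-strict A U B (proj rB) (emb rA) (proj-strict rB) (emb-strict rA)

⊥-deflation : (U : Pcpo) → Deflation U
⊥-deflation U = record
  { map   = record { fun = λ _ → U.⊥ ; cong = λ _ → U.Eq.refl ; mono = λ _ → U.refl
                   ; lub-pres = λ c x l → (λ n → U.refl) , (λ y uy → uy 0) }
  ; idem  = λ x → U.Eq.refl
  ; below = U.⊥-least }
  where module U = Pcpo U

module _ {U : Pcpo} {T : TypeCon U} (F : Functor U T) where
  private
    module U = Pcpo U
    τU : Pcpo
    τU = T · idRep U
    rτU : Representable U τU
    rτU = ·Rep T (idRep U)
    d⊥ : Deflation U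
    d⊥ = ⊥-deflation U

  -- By (F1), fmap̲(d⊥)(⊥) = fmap̲(d⊥)(proj_{τ·U}(⊥)) = T(d⊥)(⊥) ⊑ ⊥.
  fmap̲-⊥-deflation-strict : Strict τU τU (fun (fmap̲ F) (map d⊥))
  fmap̲-⊥-deflation-strict = ≤⊥⇒≈⊥ U (U.trans (U.reflexive via-F1) (below (fun T d⊥) U.⊥))
    where
    via-F1 : fun (emb rτU) (fun (fun (fmap̲ F) (map d⊥)) (Pcpo.⊥ τU)) U.≈ fun (map (fun T d⊥)) U.⊥
    via-F1 = U.Eq.trans (cong (fun (fmap̲ F) (map d⊥)) (U.Eq.sym (proj-strict rτU))) (F1 F d⊥ U.⊥)

  fmap̲-strict : (g : Continuous (poset U) (poset U)) → Strict U U g → Strict τU τU (fun (fmap̲ F) g)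
  fmap̲-strict g g-strict = begin
      fun (fun (fmap̲ F) g) ⊥τ
    ≈⟨ cong (fun (fmap̲ F) g) (τU.Eq.sym {d⊥⊥} {⊥τ} fmap̲-⊥-deflation-strict) ⟩
      fun (fun (fmap̲ F) g) d⊥⊥
    ≈⟨ τU.Eq.sym {fun (fun (fmap̲ F) (g ∘C map d⊥)) ⊥τ} {fun (fun (fmap̲ F) g) d⊥⊥} (F2 F g (map d⊥) ⊥τ) ⟩
      fun (fun (fmap̲ F) (g ∘C map d⊥)) ⊥τ
    ≈⟨ cong (fmap̲ F) {g ∘C map d⊥} {map d⊥} g∘d⊥≈d⊥ ⊥τ ⟩
      fun (fun (fmap̲ F) (map d⊥)) ⊥τ
    ≈⟨ fmap̲-⊥-deflation-strict ⟩
      ⊥τ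
    ∎
    where
    module τU = Pcpo τU
    open import Relation.Binary.Reasoning.Setoid (Poset.Eq.setoid (poset τU))
    ⊥τ : τU.Carrier
    ⊥τ = τU.⊥
    d⊥⊥ : τU.Carrier
    d⊥⊥ = fun (fun (fmap̲ F) (map d⊥)) ⊥τ
    g∘d⊥≈d⊥ : (u : U.Carrier) → fun g U.⊥ U.≈ U.⊥
    g∘d⊥≈d⊥ _ = g-strict

-- fmap_{α,β}(f) is a composite of two coercions and fmap̲ of a strict map.
theorem3 : (𝒰 : Universe) (T : TypeCon (Universe.U 𝒰)) (F : Functor (Universe.U 𝒰) T)
           {A B : Pcpo} (rA : Representable (Universe.U 𝒰) A) (rB : Representable (Universe.U 𝒰) B)
           (f : Continuous (Pcpo.poset A) (Pcpo.poset B)) →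
           Pcpo._≈_ B (fun f (Pcpo.⊥ A)) (Pcpo.⊥ B) →
           Pcpo._≈_ (T · rB) (fun (fmap F rA rB f) (Pcpo.⊥ (T · rA))) (Pcpo.⊥ (T · rB))
theorem3 𝒰 T F {A} {B} rA rB f f-strict =
  ∘-strict (T · rA) τU (T · rB) (coerce rτU (·Rep T rB)) (fun (fmap̲ F) g ∘C coerce (·Rep T rA) rτU)
    (coerce-strict rτU (·Rep T rB))
    (∘-strict (T · rA) τU τU (fun (fmap̲ F) g) (coerce (·Rep T rA) rτU)
      (fmap̲-strict F g g-strict)
      (coerce-strict (·Rep T rA) rτU))
  where
  U : Pcpo
  U = Universe.U 𝒰
  τU : Pcpo
  τU = T · idRep U
  rτU : Representable U τU
  rτU = ·Rep T (idRep U)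
  g : Continuous (poset U) (poset U)
  g = emb rB ∘C f ∘C proj rA
  g-strict : Strict U U g
  g-strict = ∘-strict U B U (emb rB) (f ∘C proj rA) (emb-strict rB)
               (∘-strict U A B f (proj rA) f-strict (proj-strict rA))
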